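{- Let $k,d$ range over nonnegative integers. Every $2$-prime binary string is either of the form $10^k10^d1$ with $k<d$, or of the form $0^{d+1}10^d1$.
   Context: For a finite binary string $s$ (indexed from $0$), let $n(s)=\{i: s_i=1\}\subseteq\mathbb{N}$. For a binary string $S$, let $\mathfrak{S}=\{n(s): s \text{ a finite contiguous substring of } S\}$; a set $B\subseteq\mathbb{N}$ is shattered if $\{c\cap B: c\in\mathfrak{S}\}$ is the power set of $B$, and $VCdim(S)$ is the largest size of a shattered set. For $d\in\mathbb{N}$, a binary string $S$ is $d$-prime if $VCdim(S)=d$ and every proper (contiguous) substring $S'$ of $S$ has $VCdim(S')<d$. $0^k$ denotes a block of $k$ zeros. -}

module Defs where

open import Data.Bool using (Bool; true; false)
open import Data.Nat using (ℕ; zero; suc; _<_; _≤_)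
open import Data.List using (List; []; _∷_; _++_; length; replicate)
open import Data.List.Membership.Propositional using (_∈_)
open import Data.List.Relation.Binary.Subset.Propositional using (_⊆_)
open import Data.List.Relation.Unary.Unique.Propositional using (Unique)
open import Data.Product using (Σ; ∃; ∃-syntax; _×_)
open import Function.Bundles using (_⇔_)
open import Relation.Binary.PropositionalEquality using (_≡_; _≢_)
open import Relation.Nullary using (¬_)

-- Binary strings, indexed from 0.
BinString : Set
BinString = List Bool

bitAt : BinString → ℕ → Bool
bitAt []       _       = false
bitAt (b ∷ _)  zero    = b
bitAt (_ ∷ s)  (suc i) = bitAt s i

-- i ∈ n(s)  iff  s_i = 1
_∈n_ : ℕ → BinString → Set
i ∈n s = bitAt s i ≡ true

Substring : BinString → BinString → Set
Substring s S = ∃[ u ] ∃[ v ] (u ++ (s ++ v) ≡ S)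

ProperSubstring : BinString → BinString → Set
ProperSubstring s S = Substring s S × s ≢ S

-- A finite set B ⊆ ℕ is represented by a duplicate-free list; |B| = length.
-- B is shattered by S: every subset C of B equals n(s) ∩ B for some substring s.
Shattered : BinString → List ℕ → Set
Shattered S B =
  ∀ (C : List ℕ) → C ⊆ B →
    ∃[ s ] (Substring s S × (∀ x → x ∈ B → (x ∈n s ⇔ x ∈ C)))

HasVCdim : BinString → ℕ → Set
HasVCdim S d =
  (∃[ B ] (Unique B × Shattered S B × length B ≡ d)) ×
  (∀ B → Unique B → Shattered S B → length B ≤ d)

Prime : ℕ → BinString → Set
Prime d S =
  HasVCdim S d ×
  (∀ S' → ProperSubstring S' S → ∃[ e ] (HasVCdim S' e × e < d))

zeros : ℕ → BinString
zeros k = replicate k false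

{-# OPTIONS --safe #-}

-- If S shatters {p, p + δ}, some factor of S has ones at distance δ and some
-- factor has a zero followed δ later by a one.  Reading a string from the right,
-- either a factor 1 0^k 1 0^d 1 (k < d) or 0^(d+1) 1 0^d 1 appears, or the ones
-- stay equally spaced, with period g + 1 and at most g leading zeros.  In the
-- latter case S is a factor of a periodic string, whose ones are exactly the
-- multiples of g + 1 up to the last one; there δ and then the position of the
-- zero are multiples of g + 1, so that zero would be a one.  Hence a string of
-- VC dimension 2 contains a factor of one of the two forms; each form shatters
-- a pair itself, so by minimality the string is that factor.

module Submission where

open import Defs
open import Data.Bool using (true; false)
open import Data.Nat using (ℕ; zero; suc; _+_; _<_; _≤_; z≤n; s≤s)
open import Data.Nat.Properties
  using (+-assoc; +-comm; ≤-refl; ≤-total; ≤-<-trans; ≤-pred; m≤m+n; <⇒≱;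
         m≤n⇒∃[o]m+o≡n; m≤n⇒m<n∨m≡n; +-cancelˡ-≤)
open import Data.Nat.Divisibility using (_∣_; _∣0; ∣-refl; ∣m∣n⇒∣m+n; ∣m+n∣m⇒∣n; ∣⇒≤)
open import Data.List using ([]; _∷_; _++_; length)
open import Data.List.Properties using (++-assoc; ++-identityʳ; ≡-dec)
open import Data.List.Relation.Unary.Any using (here; there)
open import Data.List.Relation.Unary.All using ([]; _∷_)
open import Data.List.Relation.Unary.AllPairs using ([]; _∷_)
open import Data.List.Membership.Propositional using (_∈_)
open import Data.List.Relation.Binary.Subset.Propositional using (_⊆_)
open import Data.List.Membership.DecPropositional Data.Nat._≟_ using (_∈?_)
open import Data.Product using (∃-syntax; _×_; _,_)
open import Data.Sum using (_⊎_; inj₁; inj₂)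
open import Data.Empty using (⊥-elim)
open import Function using (_∘_; id; const)
open import Function.Bundles using (_⇔_; mk⇔; Equivalence)
open import Relation.Nullary using (¬_; Dec; yes; no)
open import Relation.Binary.PropositionalEquality
  using (_≡_; _≢_; refl; sym; trans; cong; subst; module ≡-Reasoning)

open Equivalence using (to; from)

zeros-+ : ∀ m n → zeros (m + n) ≡ zeros m ++ zeros n
zeros-+ zero    n = refl
zeros-+ (suc m) n = cong (false ∷_) (zeros-+ m n)

zeros-++-zeros : ∀ m n R → zeros m ++ zeros n ++ R ≡ zeros (n + m) ++ R
zeros-++-zeros m n R = begin
  zeros m ++ zeros n ++ R    ≡⟨ ++-assoc (zeros m) (zeros n) R ⟨
  (zeros m ++ zeros n) ++ R  ≡⟨ cong (_++ R) (zeros-+ m n) ⟨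
  zeros (m + n) ++ R         ≡⟨ cong (λ k → zeros k ++ R) (+-comm m n) ⟩
  zeros (n + m) ++ R         ∎
  where open ≡-Reasoning

¬one-zeros : ∀ c {p} → ¬ (p ∈n zeros c)
¬one-zeros (suc c) {suc p} = ¬one-zeros c

bitAt-zeros-++ : ∀ g R r → bitAt (zeros g ++ R) (g + r) ≡ bitAt R r
bitAt-zeros-++ zero    R r = refl
bitAt-zeros-++ (suc g) R r = bitAt-zeros-++ g R r

one-after-zeros : ∀ g R → g ∈n (zeros g ++ true ∷ R)
one-after-zeros zero    R = refl
one-after-zeros (suc g) R = one-after-zeros g R

one-zeros-++⁻¹ : ∀ g R {p} → p ∈n (zeros g ++ R) → ∃[ r ] (p ≡ g + r × r ∈n R)
one-zeros-++⁻¹ zero    R {p}     p∈ = p , refl , p∈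
one-zeros-++⁻¹ (suc g) R {suc p} p∈ with one-zeros-++⁻¹ g R p∈
... | r , refl , r∈ = r , refl , r∈

one⇒<length : ∀ s {p} → p ∈n s → p < length s
one⇒<length (_ ∷ s) {zero}  _  = s≤s z≤n
one⇒<length (_ ∷ s) {suc p} p∈ = s≤s (one⇒<length s p∈)

bitAt-++ˡ : ∀ s v {p} → p < length s → bitAt (s ++ v) p ≡ bitAt s p
bitAt-++ˡ (_ ∷ s) v {zero}  _         = refl
bitAt-++ˡ (_ ∷ s) v {suc p} (s≤s p<n) = bitAt-++ˡ s v p<n

bitAt-++ʳ : ∀ u w p → bitAt (u ++ w) (length u + p) ≡ bitAt w p
bitAt-++ʳ []      w p = refl
bitAt-++ʳ (_ ∷ u) w p = bitAt-++ʳ u w p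

offset : ∀ {s S} → Substring s S → ℕ
offset (u , _ , _) = length u

bitAt-substring : ∀ {s S p} (s⊆S : Substring s S) → p < length s → bitAt S (offset s⊆S + p) ≡ bitAt s p
bitAt-substring {s} (u , v , refl) p<n = trans (bitAt-++ʳ u (s ++ v) _) (bitAt-++ˡ s v p<n)

one-substring : ∀ {s S p} (s⊆S : Substring s S) → p ∈n s → (offset s⊆S + p) ∈n S
one-substring {s} s⊆S p∈ = trans (bitAt-substring s⊆S (one⇒<length s p∈)) p∈

suffix-substring : ∀ u s → Substring s (u ++ s)
suffix-substring u s = u , [] , cong (u ++_) (++-identityʳ s)

ShatterPattern : BinString → Set
ShatterPattern S = ∃[ δ ] ∃[ i ] ∃[ j ]
  (i ∈n S × (i + δ) ∈n S × ¬ (j ∈n S) × (j + δ) ∈n S)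

factors⇒pattern : ∀ {S s s′} δ i j →
  Substring s S → i ∈n s → (i + δ) ∈n s →
  Substring s′ S → ¬ (j ∈n s′) → (j + δ) ∈n s′ → ShatterPattern S
factors⇒pattern {S} {s′ = s′} δ i j s⊆S i∈ iδ∈ s′⊆S j∉ jδ∈ =
  δ , offset s⊆S + i , offset s′⊆S + j ,
  one-substring s⊆S i∈ , shifted s⊆S iδ∈ , j∉ ∘ zero-at-j , shifted s′⊆S jδ∈
  where
  shifted : ∀ {t p} (t⊆S : Substring t S) → (p + δ) ∈n t → (offset t⊆S + p + δ) ∈n S
  shifted {p = p} t⊆S pδ∈ =
    subst (_∈n S) (sym (+-assoc (offset t⊆S) p δ)) (one-substring t⊆S pδ∈)
  zero-at-j : (offset s′⊆S + j) ∈n S → j ∈n s′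
  zero-at-j = trans (sym (bitAt-substring s′⊆S (≤-<-trans (m≤m+n j δ) (one⇒<length s′ jδ∈))))

substring-pattern : ∀ {s S} → Substring s S → ShatterPattern s → ShatterPattern S
substring-pattern s⊆S (δ , i , j , i∈ , iδ∈ , j∉ , jδ∈) =
  factors⇒pattern δ i j s⊆S i∈ iδ∈ s⊆S j∉ jδ∈

data Periodic (g : ℕ) : BinString → Set where
  last : ∀ c → Periodic g (true ∷ zeros c)
  cons : ∀ {R} → Periodic g R → Periodic g (true ∷ zeros g ++ R)

periodic-head : ∀ {g T} → Periodic g T → ∃[ R ] (T ≡ true ∷ R)
periodic-head (last c) = _ , refl
periodic-head (cons P) = _ , refl

periodic-one⇒∣ : ∀ {g T} → Periodic g T → ∀ {p} → p ∈n T → suc g ∣ p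
periodic-one⇒∣ _                 {zero}  _  = _ ∣0
periodic-one⇒∣ (last c)          {suc p} p∈ = ⊥-elim (¬one-zeros c p∈)
periodic-one⇒∣ {g} (cons {R} P) {suc p} p∈ with one-zeros-++⁻¹ g R p∈
... | r , refl , r∈ = ∣m∣n⇒∣m+n ∣-refl (periodic-one⇒∣ P r∈)

periodic-∣⇒one : ∀ {g T} → Periodic g T → ∀ {p q} → q ∈n T → suc g ∣ p → p ≤ q → p ∈n T
periodic-∣⇒one (last c) {zero}  _ _ _ = refl
periodic-∣⇒one (cons P) {zero}  _ _ _ = refl
periodic-∣⇒one _        {suc p} {zero} _ _ ()
periodic-∣⇒one (last c) {suc p} {suc q} q∈ _ _ = ⊥-elim (¬one-zeros c q∈)
periodic-∣⇒one {g} (cons {R} P) {suc p} {suc q} q∈ period∣p (s≤s p≤q)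
  with one-zeros-++⁻¹ g R q∈ | m≤n⇒∃[o]m+o≡n (≤-pred (∣⇒≤ period∣p))
... | r , refl , r∈ | p′ , refl =
  trans (bitAt-zeros-++ g R p′)
        (periodic-∣⇒one P r∈ (∣m+n∣m⇒∣n period∣p ∣-refl) (+-cancelˡ-≤ g p′ r p≤q))

periodic-¬pattern : ∀ {g T} → Periodic g T → ¬ ShatterPattern T
periodic-¬pattern {g} P (δ , i , j , i∈ , iδ∈ , j∉ , jδ∈) =
  j∉ (periodic-∣⇒one P jδ∈ period∣j (m≤m+n j δ))
  where
  period∣δ : suc g ∣ δ
  period∣δ = ∣m+n∣m⇒∣n (periodic-one⇒∣ P iδ∈) (periodic-one⇒∣ P i∈)
  period∣j : suc g ∣ j
  period∣j = ∣m+n∣m⇒∣n (subst (suc g ∣_) (+-comm j δ) (periodic-one⇒∣ P jδ∈)) period∣δ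

data Regular : BinString → Set where
  allZero  : ∀ a → Regular (zeros a)
  periodic : ∀ a g {T} → a ≤ g → Periodic g T → Regular (zeros a ++ T)

regular⇒substring-periodic : ∀ {S} → Regular S → ∃[ g ] ∃[ P ] (Periodic g P × Substring S P)
regular⇒substring-periodic (allZero a) = 0 , _ , last a , suffix-substring (true ∷ []) (zeros a)
regular⇒substring-periodic (periodic a g {T} a≤g P) with m≤n⇒∃[o]m+o≡n a≤g
... | e , refl =
  -- 0^a T is a suffix of 1 0^(a + e) T
  a + e , _ , cons P ,
  subst (Substring (zeros a ++ T)) (cong (true ∷_) (zeros-++-zeros e a T))
        (suffix-substring (true ∷ zeros e) (zeros a ++ T))

regular-¬pattern : ∀ {S} → Regular S → ¬ ShatterPattern S
regular-¬pattern reg pat with regular⇒substring-periodic reg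
... | _ , _ , P , S⊆P = periodic-¬pattern P (substring-pattern S⊆P pat)

Prime2Form : BinString → Set
Prime2Form T = (∃[ k ] ∃[ d ] (k < d × T ≡ true ∷ zeros k ++ true ∷ zeros d ++ true ∷ []))
             ⊎ (∃[ d ] (T ≡ zeros (suc d) ++ true ∷ zeros d ++ true ∷ []))

ContainsPrime2Form : BinString → Set
ContainsPrime2Form S = ∃[ T ] (Substring T S × Prime2Form T)

prime2Form-prefix : ∀ x y R → Prime2Form (x ++ true ∷ y ++ true ∷ []) →
                    ContainsPrime2Form (x ++ true ∷ y ++ true ∷ R)
prime2Form-prefix x y R form = _ , ([] , R , reassociate) , form
  where
  open ≡-Reasoning
  reassociate : (x ++ true ∷ y ++ true ∷ []) ++ R ≡ x ++ true ∷ y ++ true ∷ R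
  reassociate = begin
    (x ++ true ∷ y ++ true ∷ []) ++ R   ≡⟨ ++-assoc x _ R ⟩
    x ++ true ∷ (y ++ true ∷ []) ++ R   ≡⟨ cong (λ w → x ++ true ∷ w) (++-assoc y _ R) ⟩
    x ++ true ∷ y ++ true ∷ R           ∎

cons-regular : ∀ b {S} → Regular S → Regular (b ∷ S) ⊎ ContainsPrime2Form (b ∷ S)
cons-regular false (allZero a) = inj₁ (allZero (suc a))
cons-regular true  (allZero a) = inj₁ (periodic 0 0 z≤n (last a))
cons-regular false (periodic a g a≤g P) with m≤n⇒m<n∨m≡n a≤g
... | inj₁ a<g = inj₁ (periodic (suc a) g a<g P)
cons-regular false (periodic a _ _ (last c)) | inj₂ refl =
  inj₁ (periodic (suc a) (suc a) ≤-refl (last c))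
cons-regular false (periodic a _ _ (cons P)) | inj₂ refl with periodic-head P
... | R , refl = inj₂ (prime2Form-prefix (zeros (suc a)) (zeros a) R (inj₂ (a , refl)))
cons-regular true (periodic a g _ (last c)) = inj₁ (periodic 0 a z≤n (cons (last c)))
cons-regular true (periodic a g a≤g (cons P)) with m≤n⇒m<n∨m≡n a≤g
... | inj₂ refl = inj₁ (periodic 0 a z≤n (cons (cons P)))
... | inj₁ a<g with periodic-head P
...   | R , refl = inj₂ (prime2Form-prefix (true ∷ zeros a) (zeros g) R (inj₁ (a , g , a<g , refl)))

regular⊎containsPrime2Form : ∀ S → Regular S ⊎ ContainsPrime2Form S
regular⊎containsPrime2Form []      = inj₁ (allZero 0)
regular⊎containsPrime2Form (b ∷ S) with regular⊎containsPrime2Form S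
... | inj₁ reg                          = cons-regular b reg
... | inj₂ (T , (u , v , T⊆S) , form) = inj₂ (T , (b ∷ u , v , cong (b ∷_) T⊆S) , form)

⇔-both : ∀ {P Q : Set} → P → Q → P ⇔ Q
⇔-both p q = mk⇔ (const q) (const p)

⇔-neither : ∀ {P Q : Set} → ¬ P → ¬ Q → P ⇔ Q
⇔-neither ¬p ¬q = mk⇔ (⊥-elim ∘ ¬p) (⊥-elim ∘ ¬q)

shatters-pair : ∀ {T x y} →
  ∃[ s ] (Substring s T × x ∈n s × y ∈n s) →
  ∃[ s ] (Substring s T × x ∈n s × ¬ (y ∈n s)) →
  ∃[ s ] (Substring s T × ¬ (x ∈n s) × y ∈n s) →
  Shattered T (x ∷ y ∷ [])
shatters-pair {T} {x} {y} both onlyX onlyY C _ = pick (x ∈? C) (y ∈? C)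
  where
  Realised : Set
  Realised = ∃[ s ] (Substring s T × (∀ z → z ∈ x ∷ y ∷ [] → (z ∈n s ⇔ z ∈ C)))

  realised : ∀ {s} → Substring s T → (x ∈n s ⇔ x ∈ C) → (y ∈n s ⇔ y ∈ C) → Realised
  realised s⊆T x⇔ y⇔ = _ , s⊆T , λ { _ (here refl) → x⇔ ; _ (there (here refl)) → y⇔ ; _ (there (there ())) }

  pick : Dec (x ∈ C) → Dec (y ∈ C) → Realised
  pick (yes x∈C) (yes y∈C) = let s , s⊆T , x∈s , y∈s = both in
    realised s⊆T (⇔-both x∈s x∈C) (⇔-both y∈s y∈C)
  pick (yes x∈C) (no y∉C)  = let s , s⊆T , x∈s , y∉s = onlyX in
    realised s⊆T (⇔-both x∈s x∈C) (⇔-neither y∉s y∉C)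
  pick (no x∉C)  (yes y∈C) = let s , s⊆T , x∉s , y∈s = onlyY in
    realised s⊆T (⇔-neither x∉s x∉C) (⇔-both y∈s y∈C)
  pick (no x∉C)  (no y∉C)  =
    realised ([] , T , refl) (⇔-neither (λ ()) x∉C) (⇔-neither (λ ()) y∉C)

prime2Form-shatters : ∀ {T} → Prime2Form T → ∃[ y ] Shattered T (0 ∷ suc y ∷ [])
prime2Form-shatters (inj₁ (k , d , k<d , refl)) with m≤n⇒∃[o]m+o≡n k<d
... | m , refl = k , shatters-pair
  (_ , ([] , [] , ++-identityʳ _) , refl , one-after-zeros k _)
  (true ∷ [] , ([] , _ , refl) , refl , λ ())
  (_ , subst (Substring (zeros (suc k) ++ true ∷ [])) split (suffix-substring (true ∷ zeros k ++ true ∷ zeros m) _) ,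
   (λ ()) , one-after-zeros k [])
  where
  split : (true ∷ zeros k ++ true ∷ zeros m) ++ zeros (suc k) ++ true ∷ []
        ≡ true ∷ zeros k ++ true ∷ zeros (suc k + m) ++ true ∷ []
  split = cong (true ∷_) (trans (++-assoc (zeros k) _ _)
                                (cong (λ w → zeros k ++ true ∷ w) (zeros-++-zeros m (suc k) _)))
prime2Form-shatters (inj₂ (d , refl)) = d , shatters-pair
  (_ , suffix-substring (zeros (suc d)) _ , refl , one-after-zeros d [])
  (true ∷ [] , (zeros (suc d) , _ , refl) , refl , λ ())
  (_ , ([] , [] , ++-identityʳ _) , (λ ()) , one-after-zeros d _)

prime2Form⇒2≤vcdim : ∀ {T e} → Prime2Form T → HasVCdim T e → 2 ≤ e
prime2Form⇒2≤vcdim form (_ , maximal) with prime2Form-shatters form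
... | _ , shattered = maximal _ (((λ ()) ∷ []) ∷ [] ∷ []) shattered

Shattered-cong : ∀ {S B B′} → B ⊆ B′ → B′ ⊆ B → Shattered S B → Shattered S B′
Shattered-cong B⊆B′ B′⊆B shattered C C⊆B′ with shattered C (B′⊆B ∘ C⊆B′)
... | s , s⊆S , agree = s , s⊆S , λ x → agree x ∘ B′⊆B

ordered-pair⇒pattern : ∀ {S lo hi} → lo ≤ hi → lo ≢ hi →
                       Shattered S (lo ∷ hi ∷ []) → ShatterPattern S
ordered-pair⇒pattern {lo = lo} {hi} lo≤hi lo≢hi shattered
  with m≤n⇒∃[o]m+o≡n lo≤hi
     | shattered (lo ∷ hi ∷ []) id
     | shattered (hi ∷ []) (λ { (here refl) → there (here refl) ; (there ()) })
... | δ , refl | s , s⊆S , agree | s′ , s′⊆S , agree′ =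
  factors⇒pattern δ lo lo
    s⊆S  (from (agree lo lo∈) lo∈) (from (agree hi hi∈) hi∈)
    s′⊆S (lo∉[hi] ∘ to (agree′ lo lo∈)) (from (agree′ hi hi∈) (here refl))
  where
  lo∈ : lo ∈ lo ∷ hi ∷ []
  lo∈ = here refl
  hi∈ : hi ∈ lo ∷ hi ∷ []
  hi∈ = there (here refl)
  lo∉[hi] : ¬ (lo ∈ hi ∷ [])
  lo∉[hi] (here eq) = lo≢hi eq

shattered-pair⇒pattern : ∀ {S a b} → a ≢ b → Shattered S (a ∷ b ∷ []) → ShatterPattern S
shattered-pair⇒pattern {a = a} {b} a≢b shattered with ≤-total a b
... | inj₁ a≤b = ordered-pair⇒pattern a≤b a≢b shattered
... | inj₂ b≤a = ordered-pair⇒pattern b≤a (a≢b ∘ sym) (Shattered-cong swap swap shattered)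
  where
  swap : ∀ {x y} → x ∷ y ∷ [] ⊆ y ∷ x ∷ []
  swap (here eq)         = there (here eq)
  swap (there (here eq)) = here eq

vcdim2⇒pattern : ∀ {S} → HasVCdim S 2 → ShatterPattern S
vcdim2⇒pattern ((_ ∷ _ ∷ [] , (a≢b ∷ []) ∷ _ , shattered , refl) , _) =
  shattered-pair⇒pattern a≢b shattered

theorem7 : ∀ S → Prime 2 S →
    (∃[ k ] ∃[ d ] (k < d × S ≡ true ∷ zeros k ++ true ∷ zeros d ++ true ∷ []))
    ⊎ (∃[ d ] (S ≡ zeros (suc d) ++ true ∷ zeros d ++ true ∷ []))
theorem7 S (vcdim2 , minimal) with regular⊎containsPrime2Form S
... | inj₁ reg = ⊥-elim (regular-¬pattern reg (vcdim2⇒pattern vcdim2))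
... | inj₂ (T , T⊆S , form) with ≡-dec Data.Bool._≟_ T S
...   | yes refl = form
...   | no T≢S with minimal T (T⊆S , T≢S)
...     | e , vcdimT , e<2 = ⊥-elim (<⇒≱ e<2 (prime2Form⇒2≤vcdim form vcdimT))
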